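{- Let $k\ge 0$ be an integer and $G$ a graph with $\mu_\alpha(G)\leq k$. Then every internal vertex of $G$ is adjacent to at most $k+1$ leaves.
   Context: All graphs are finite and simple. For a graph $G$, $\alpha(G)$ is the maximum size of an independent set, $i(G)$ is the minimum size of an inclusion-maximal independent set, and $\mu_\alpha(G)=\alpha(G)-i(G)$. Let $U$ be the set of vertices whose connected component in $G$ is a complete graph; in $G-U$, a leaf is a vertex of degree $1$ and an internal vertex is a vertex of $G-U$ that is not a leaf. -}

module Defs where

open import Data.Nat using (ℕ; _+_; _≤_; suc)
open import Data.Bool using (Bool; true; false)
open import Data.Fin using (Fin)
open import Data.Fin.Subset using (Subset; _∈_; _∉_; _⊆_; ∣_∣)
open import Data.Product using (Σ; _×_; ∃)
open import Data.List using (List; length)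
open import Data.List.Relation.Unary.All using (All)
open import Data.List.Relation.Unary.Unique.Propositional using (Unique)
open import Relation.Binary.PropositionalEquality using (_≡_; _≢_)
open import Relation.Nullary using (¬_)

record Graph : Set where
  field
    n      : ℕ
    adj    : Fin n → Fin n → Bool
    sym    : ∀ u v → adj u v ≡ adj v u
    irrefl : ∀ v → adj v v ≡ false
open Graph public

module _ (G : Graph) where

  Vertex : Set
  Vertex = Fin (n G)

  Adj : Vertex → Vertex → Set
  Adj u v = adj G u v ≡ true

  Independent : Subset (n G) → Set
  Independent S = ∀ u v → u ∈ S → v ∈ S → adj G u v ≡ false

  MaximalIndependent : Subset (n G) → Set
  MaximalIndependent S =
    Independent S × (∀ T → Independent T → S ⊆ T → T ⊆ S)

  -- μ_α(G) = α(G) - i(G) ≤ k, i.e. every independent set has size at most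
  -- (size of any maximal independent set) + k.
  MuAlphaAtMost : ℕ → Set
  MuAlphaAtMost k = ∀ S T → Independent S → MaximalIndependent T → ∣ S ∣ ≤ ∣ T ∣ + k

  data Reach (u : Vertex) : Vertex → Set where
    here : Reach u u
    step : ∀ {v w} → Reach u v → Adj v w → Reach u w

  -- v ∈ U: the connected component of v induces a complete graph
  InU : Vertex → Set
  InU v = ∀ x y → Reach v x → Reach v y → x ≢ y → Adj x y

  -- leaf of G - U: vertex of G - U with exactly one neighbour in G - U
  Leaf : Vertex → Set
  Leaf w = ¬ InU w × ∃ λ u → Adj w u × ¬ InU u × (∀ u' → Adj w u' → ¬ InU u' → u' ≡ u)

  Internal : Vertex → Set
  Internal w = ¬ InU w × ¬ Leaf w

  AdjLeavesAtMost : Vertex → ℕ → Set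
  AdjLeavesAtMost v m = ∀ (L : List Vertex) → Unique L → All (λ x → Leaf x × Adj v x) L → length L ≤ m

-- Extend {v} to a maximal independent set T. The leaves at v lie outside T, and they
-- are independent from each other and from T - v, because the only neighbour of a leaf
-- outside U is v and U is a union of components. So replacing v by the ℓ leaves at v
-- yields an independent set of size |T| - 1 + ℓ, and μ_α(G) ≤ k gives ℓ - 1 ≤ k.
module Submission where

open import Defs
open import Data.Nat using (ℕ; suc; _+_; _≤_; _<_; _∸_)
open import Data.Nat.Properties
  using (+-suc; +-identityʳ; +-assoc; +-comm; m≤m+n; +-monoˡ-≤; +-cancelˡ-≤; ∸-monoʳ-<; module ≤-Reasoning)
open import Data.Nat.Induction using (<-wellFounded)
open import Induction.WellFounded using (Acc; acc)
open import Data.Bool using (false)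
open import Data.Bool.Properties using (¬-not) renaming (_≟_ to _≟ᴮ_)
open import Data.Fin using (Fin) renaming (_≟_ to _≟ᶠ_)
open import Data.Fin.Properties using (any?; all?)
open import Data.Fin.Subset
  using (Subset; _∈_; _∉_; _⊆_; _⊂_; ∣_∣; ⁅_⁆; _∪_; _∩_; _─_; _-_; ⊥; ⋃; Empty; inside; outside)
open import Data.Fin.Subset.Properties
open import Data.Vec.Base using ([]; _∷_; here; there)
open import Data.List using (List; []; _∷_; length; map)
open import Data.List.Membership.Propositional using () renaming (_∈_ to _∈ˡ_)
import Data.List.Relation.Unary.All as All
open import Data.List.Relation.Unary.Any using () renaming (here to hereˡ; there to thereˡ)
open import Data.List.Relation.Unary.AllPairs using (_∷_)
open import Data.List.Relation.Unary.Unique.Propositional using (Unique)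
open import Data.Product using (_×_; ∃; _,_; proj₂)
open import Data.Sum using (inj₁; inj₂)
open import Relation.Binary.PropositionalEquality
  using (_≡_; _≢_; refl; cong; cong₂; subst; trans; module ≡-Reasoning) renaming (sym to ≡-sym)
open import Relation.Nullary using (¬_; Dec; yes; no; ¬?; _×-dec_; _→-dec_)
open import Relation.Nullary.Negation using (contradiction)

∣p∪q∣+∣p∩q∣≡∣p∣+∣q∣ : ∀ {n} (p q : Subset n) → ∣ p ∪ q ∣ + ∣ p ∩ q ∣ ≡ ∣ p ∣ + ∣ q ∣
∣p∪q∣+∣p∩q∣≡∣p∣+∣q∣ []            []            = refl
∣p∪q∣+∣p∩q∣≡∣p∣+∣q∣ (inside  ∷ p) (inside  ∷ q) = cong suc (begin
  ∣ p ∪ q ∣ + suc ∣ p ∩ q ∣  ≡⟨ +-suc _ _ ⟩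
  suc (∣ p ∪ q ∣ + ∣ p ∩ q ∣) ≡⟨ cong suc (∣p∪q∣+∣p∩q∣≡∣p∣+∣q∣ p q) ⟩
  suc (∣ p ∣ + ∣ q ∣)         ≡⟨ +-suc _ _ ⟨
  ∣ p ∣ + suc ∣ q ∣           ∎)
  where open ≡-Reasoning
∣p∪q∣+∣p∩q∣≡∣p∣+∣q∣ (inside  ∷ p) (outside ∷ q) = cong suc (∣p∪q∣+∣p∩q∣≡∣p∣+∣q∣ p q)
∣p∪q∣+∣p∩q∣≡∣p∣+∣q∣ (outside ∷ p) (inside  ∷ q) =
  trans (cong suc (∣p∪q∣+∣p∩q∣≡∣p∣+∣q∣ p q)) (≡-sym (+-suc _ _))
∣p∪q∣+∣p∩q∣≡∣p∣+∣q∣ (outside ∷ p) (outside ∷ q) = ∣p∪q∣+∣p∩q∣≡∣p∣+∣q∣ p q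

∣p∪q∣≤∣p∣+∣q∣ : ∀ {n} (p q : Subset n) → ∣ p ∪ q ∣ ≤ ∣ p ∣ + ∣ q ∣
∣p∪q∣≤∣p∣+∣q∣ p q = subst (∣ p ∪ q ∣ ≤_) (∣p∪q∣+∣p∩q∣≡∣p∣+∣q∣ p q) (m≤m+n _ _)

Empty[p∩q]⇒∣p∪q∣≡∣p∣+∣q∣ : ∀ {n} (p q : Subset n) → Empty (p ∩ q) → ∣ p ∪ q ∣ ≡ ∣ p ∣ + ∣ q ∣
Empty[p∩q]⇒∣p∪q∣≡∣p∣+∣q∣ {n} p q disjoint = begin
  ∣ p ∪ q ∣             ≡⟨ +-identityʳ _ ⟨
  ∣ p ∪ q ∣ + 0         ≡⟨ cong (∣ p ∪ q ∣ +_) (∣⊥∣≡0 n) ⟨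
  ∣ p ∪ q ∣ + ∣ ⊥ {n} ∣ ≡⟨ cong (λ r → ∣ p ∪ q ∣ + ∣ r ∣) (Empty-unique disjoint) ⟨
  ∣ p ∪ q ∣ + ∣ p ∩ q ∣ ≡⟨ ∣p∪q∣+∣p∩q∣≡∣p∣+∣q∣ p q ⟩
  ∣ p ∣ + ∣ q ∣         ∎
  where open ≡-Reasoning

x∈p─q⇒x∉q : ∀ {n} {x : Fin n} (p q : Subset n) → x ∈ p ─ q → x ∉ q
x∈p─q⇒x∉q (inside ∷ p) (outside ∷ q) here      ()
x∈p─q⇒x∉q (_      ∷ p) (_       ∷ q) (there i) (there j) = x∈p─q⇒x∉q p q i j

∣p∣≤∣p-x∣+1 : ∀ {n} (p : Subset n) (x : Fin n) → ∣ p ∣ ≤ ∣ p - x ∣ + 1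
∣p∣≤∣p-x∣+1 p x = begin
  ∣ p ∣                   ≤⟨ p⊆q⇒∣p∣≤∣q∣ p⊆[p-x]∪⁅x⁆ ⟩
  ∣ (p - x) ∪ ⁅ x ⁆ ∣     ≤⟨ ∣p∪q∣≤∣p∣+∣q∣ (p - x) ⁅ x ⁆ ⟩
  ∣ p - x ∣ + ∣ ⁅ x ⁆ ∣   ≡⟨ cong (∣ p - x ∣ +_) (∣⁅x⁆∣≡1 x) ⟩
  ∣ p - x ∣ + 1           ∎
  where
  open ≤-Reasoning
  p⊆[p-x]∪⁅x⁆ : p ⊆ (p - x) ∪ ⁅ x ⁆
  p⊆[p-x]∪⁅x⁆ {y} y∈p with y ≟ᶠ x
  ... | yes refl = x∈p∪q⁺ (inj₂ (x∈⁅x⁆ x))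
  ... | no  y≢x  = x∈p∪q⁺ (inj₁ (x∈p∧x≢y⇒x∈p-y y∈p y≢x))

fromList : ∀ {n} → List (Fin n) → Subset n
fromList xs = ⋃ (map ⁅_⁆ xs)

x∈fromList⁻ : ∀ {n} {x : Fin n} (xs : List (Fin n)) → x ∈ fromList xs → x ∈ˡ xs
x∈fromList⁻ []       x∈ = contradiction x∈ ∉⊥
x∈fromList⁻ (y ∷ xs) x∈ with x∈p∪q⁻ ⁅ y ⁆ (fromList xs) x∈
... | inj₁ x∈⁅y⁆ = hereˡ (x∈⁅y⁆⇒x≡y y x∈⁅y⁆)
... | inj₂ x∈xs  = thereˡ (x∈fromList⁻ xs x∈xs)

∣fromList∣≡length : ∀ {n} (xs : List (Fin n)) → Unique xs → ∣ fromList xs ∣ ≡ length xs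
∣fromList∣≡length {n} []       _               = ∣⊥∣≡0 n
∣fromList∣≡length (x ∷ xs) (x∉xs ∷ unique) = begin
  ∣ ⁅ x ⁆ ∪ fromList xs ∣         ≡⟨ Empty[p∩q]⇒∣p∪q∣≡∣p∣+∣q∣ ⁅ x ⁆ (fromList xs) disjoint ⟩
  ∣ ⁅ x ⁆ ∣ + ∣ fromList xs ∣     ≡⟨ cong₂ _+_ (∣⁅x⁆∣≡1 x) (∣fromList∣≡length xs unique) ⟩
  suc (length xs)                 ∎
  where
  open ≡-Reasoning
  disjoint : Empty (⁅ x ⁆ ∩ fromList xs)
  disjoint (y , y∈) with x∈p∩q⁻ ⁅ x ⁆ (fromList xs) y∈
  ... | y∈⁅x⁆ , y∈xs with x∈⁅y⁆⇒x≡y x y∈⁅x⁆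
  ... | refl = All.lookup x∉xs (x∈fromList⁻ xs y∈xs) refl

module _ (G : Graph) where

  Adj-sym : ∀ {u w} → Adj G u w → Adj G w u
  Adj-sym {u} {w} uw = trans (Graph.sym G w u) uw

  ¬Adj⇒adj≡false : ∀ {u w} → ¬ Adj G u w → adj G u w ≡ false
  ¬Adj⇒adj≡false = ¬-not

  Adj⇒adj≢false : ∀ {u w} → Adj G u w → adj G u w ≢ false
  Adj⇒adj≢false uw uw≡false with trans (≡-sym uw) uw≡false
  ... | ()

  Reach-trans : ∀ {u v w} → Reach G u v → Reach G v w → Reach G u w
  Reach-trans r here         = r
  Reach-trans r (step r′ vw) = step (Reach-trans r r′) vw

  ¬InU-adj : ∀ {u w} → Adj G u w → ¬ InU G u → ¬ InU G w
  ¬InU-adj uw u∉U w∈U = u∉U λ x y rx ry →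
    w∈U x y (Reach-trans (step here (Adj-sym uw)) rx) (Reach-trans (step here (Adj-sym uw)) ry)

  LeafAt : Vertex G → Vertex G → Set
  LeafAt v w = Leaf G w × Adj G v w

  -- Since U is a union of components, every neighbour of the leaf w lies outside U.
  LeafAt⇒neighbour≡ : ∀ {v w u} → LeafAt v w → Adj G w u → u ≡ v
  LeafAt⇒neighbour≡ ((w∉U , _ , _ , _ , unique) , vw) wu =
    trans (unique _ wu (¬InU-adj wu w∉U)) (≡-sym (unique _ (Adj-sym vw) (¬InU-adj (Adj-sym vw) w∉U)))

  Independent-⊆ : ∀ {p q} → q ⊆ p → Independent G p → Independent G q
  Independent-⊆ q⊆p indP u w u∈q w∈q = indP u w (q⊆p u∈q) (q⊆p w∈q)

  Independent-⁅⁆ : ∀ v → Independent G ⁅ v ⁆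
  Independent-⁅⁆ v u w u∈ w∈ rewrite x∈⁅y⁆⇒x≡y v u∈ | x∈⁅y⁆⇒x≡y v w∈ = Graph.irrefl G v

  Independent-∪ : ∀ {p q} → Independent G p → Independent G q →
                  (∀ u w → u ∈ p → w ∈ q → adj G u w ≡ false) → Independent G (p ∪ q)
  Independent-∪ {p} {q} indP indQ cross u w u∈ w∈ with x∈p∪q⁻ p q u∈ | x∈p∪q⁻ p q w∈
  ... | inj₁ u∈p | inj₁ w∈p = indP u w u∈p w∈p
  ... | inj₁ u∈p | inj₂ w∈q = cross u w u∈p w∈q
  ... | inj₂ u∈q | inj₁ w∈p = trans (Graph.sym G u w) (cross w u w∈p u∈q)
  ... | inj₂ u∈q | inj₂ w∈q = indQ u w u∈q w∈q

  Independent⇒adj∉ : ∀ {T v w} → Independent G T → v ∈ T → Adj G v w → w ∉ T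
  Independent⇒adj∉ indT v∈T vw w∈T = Adj⇒adj≢false vw (indT _ _ v∈T w∈T)

  Addable : Subset (n G) → Vertex G → Set
  Addable S w = w ∉ S × (∀ u → u ∈ S → adj G w u ≡ false)

  addable? : ∀ S w → Dec (Addable S w)
  addable? S w = ¬? (w ∈? S) ×-dec all? (λ u → (u ∈? S) →-dec (adj G w u ≟ᴮ false))

  Independent-addable : ∀ {S w} → Independent G S → Addable S w → Independent G (S ∪ ⁅ w ⁆)
  Independent-addable {S} {w} indS (_ , w↮S) = Independent-∪ indS (Independent-⁅⁆ w) cross
    where
    cross : ∀ u x → u ∈ S → x ∈ ⁅ w ⁆ → adj G u x ≡ false
    cross u x u∈S x∈⁅w⁆ rewrite x∈⁅y⁆⇒x≡y w x∈⁅w⁆ = trans (Graph.sym G u w) (w↮S u u∈S)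

  ¬Addable⇒MaximalIndependent : ∀ {S} → Independent G S → ¬ ∃ (Addable S) → MaximalIndependent G S
  ¬Addable⇒MaximalIndependent {S} indS none = indS , maximal
    where
    maximal : ∀ T → Independent G T → S ⊆ T → T ⊆ S
    maximal T indT S⊆T {x} x∈T with x ∈? S
    ... | yes x∈S = x∈S
    ... | no  x∉S = contradiction (x , x∉S , λ u u∈S → indT x u x∈T (S⊆T u∈S)) none

  extendToMaximal : ∀ S → Independent G S → Acc _<_ (n G ∸ ∣ S ∣) →
                    ∃ λ T → S ⊆ T × MaximalIndependent G T
  extendToMaximal S indS (acc rec) with any? (addable? S)
  ... | no  none = S , (λ x∈S → x∈S) , ¬Addable⇒MaximalIndependent indS none
  ... | yes (w , addable@(w∉S , _))
    with extendToMaximal (S ∪ ⁅ w ⁆) (Independent-addable indS addable) (rec fewerOutside)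
    where
    S⊂S∪⁅w⁆ : S ⊂ S ∪ ⁅ w ⁆
    S⊂S∪⁅w⁆ = (λ {x} → p⊆p∪q ⁅ w ⁆) , w , x∈p∪q⁺ (inj₂ (x∈⁅x⁆ w)) , w∉S
    fewerOutside : n G ∸ ∣ S ∪ ⁅ w ⁆ ∣ < n G ∸ ∣ S ∣
    fewerOutside = ∸-monoʳ-< (p⊂q⇒∣p∣<∣q∣ S⊂S∪⁅w⁆) (∣p∣≤n (S ∪ ⁅ w ⁆))
  ... | T , S∪⁅w⁆⊆T , maxT = T , (λ x∈S → S∪⁅w⁆⊆T (p⊆p∪q ⁅ w ⁆ x∈S)) , maxT

  Independent⇒⊆MaximalIndependent : ∀ S → Independent G S → ∃ λ T → S ⊆ T × MaximalIndependent G T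
  Independent⇒⊆MaximalIndependent S indS = extendToMaximal S indS (<-wellFounded _)

  LeavesAt : Vertex G → Subset (n G) → Set
  LeavesAt v p = ∀ {w} → w ∈ p → LeafAt v w

  LeavesAt⇒Independent : ∀ {v p} → LeavesAt v p → Independent G p
  LeavesAt⇒Independent {v} leaves u w u∈p w∈p = ¬Adj⇒adj≡false λ uw →
    Adj⇒adj≢false (subst (Adj G v) (LeafAt⇒neighbour≡ (leaves u∈p) uw) (proj₂ (leaves w∈p)))
      (Graph.irrefl G v)

  LeavesAt-disjoint : ∀ {T v p} → Independent G T → v ∈ T → LeavesAt v p → Empty ((T - v) ∩ p)
  LeavesAt-disjoint {T} {v} {p} indT v∈T leaves (w , w∈) with x∈p∩q⁻ (T - v) p w∈
  ... | w∈T-v , w∈p = Independent⇒adj∉ indT v∈T (proj₂ (leaves w∈p)) (p─q⊆p T ⁅ v ⁆ w∈T-v)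

  Independent-exchangeLeaves : ∀ {T v p} → Independent G T → LeavesAt v p → Independent G ((T - v) ∪ p)
  Independent-exchangeLeaves {T} {v} {p} indT leaves =
    Independent-∪ (Independent-⊆ (p─q⊆p T ⁅ v ⁆) indT) (LeavesAt⇒Independent leaves) cross
    where
    cross : ∀ u w → u ∈ T - v → w ∈ p → adj G u w ≡ false
    cross u w u∈T-v w∈p = ¬Adj⇒adj≡false λ uw →
      x∉⁅y⁆⇒x≢y (x∈p─q⇒x∉q T ⁅ v ⁆ u∈T-v) (LeafAt⇒neighbour≡ (leaves w∈p) (Adj-sym uw))

lemma2p5 : (k : ℕ) (G : Graph) → MuAlphaAtMost G k →
    ∀ (v : Vertex G) → Internal G v → AdjLeavesAtMost G v (k + 1)
lemma2p5 k G μ≤k v _ L unique leaves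
  with Independent⇒⊆MaximalIndependent G ⁅ v ⁆ (Independent-⁅⁆ G v)
... | T , ⁅v⁆⊆T , maxT@(indT , _) = +-cancelˡ-≤ ∣ T - v ∣ (length L) (k + 1) (begin
  ∣ T - v ∣ + length L  ≡⟨ ∣S∣≡ ⟨
  ∣ S ∣                 ≤⟨ μ≤k S T (Independent-exchangeLeaves G indT leavesL) maxT ⟩
  ∣ T ∣ + k             ≤⟨ +-monoˡ-≤ k (∣p∣≤∣p-x∣+1 T v) ⟩
  ∣ T - v ∣ + 1 + k     ≡⟨ +-assoc _ 1 k ⟩
  ∣ T - v ∣ + (1 + k)   ≡⟨ cong (∣ T - v ∣ +_) (+-comm 1 k) ⟩
  ∣ T - v ∣ + (k + 1)   ∎)
  where
  open ≤-Reasoning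
  S : Subset (n G)
  S = (T - v) ∪ fromList L
  leavesL : LeavesAt G v (fromList L)
  leavesL w∈ = All.lookup leaves (x∈fromList⁻ L w∈)
  ∣S∣≡ : ∣ S ∣ ≡ ∣ T - v ∣ + length L
  ∣S∣≡ = trans (Empty[p∩q]⇒∣p∪q∣≡∣p∣+∣q∣ (T - v) (fromList L)
                  (LeavesAt-disjoint G indT (⁅v⁆⊆T (x∈⁅x⁆ v)) leavesL))
               (cong (∣ T - v ∣ +_) (∣fromList∣≡length L unique))
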